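{- If $G$ is a graph of chordality at most $4$, then for any non-negative integer $p$ and any minimal $K_p$-induced minor structure of $G$, each bag is a clique of $G$.
   Context: All graphs are finite, simple and undirected. The chordality of $G$ is the length of a longest induced cycle of $G$ (and $0$ if $G$ has no cycles). Two disjoint vertex sets $X,Y$ are adjacent if some vertex of $X$ is adjacent to some vertex of $Y$. A $K_p$-induced minor structure of $G$ is a family $\mathcal{W}=\{W(x)\mid x\in V(K_p)\}$ of pairwise disjoint nonempty subsets of $V(G)$ (called bags; not necessarily covering $V(G)$) such that each $G[W(x)]$ is connected and every two distinct bags are adjacent. Such a structure is minimal if there is no $K_p$-induced minor structure $\{W'(x)\mid x\in V(K_p)\}$ with $W'(x)\subseteq W(x)$ for all $x$ and at least one inclusion proper. -}

module Defs where

open import Data.Nat using (ℕ; zero; suc; _≤_; _∸_)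
open import Data.Fin using (Fin; toℕ)
open import Data.Fin.Subset using (Subset; _∈_; _∉_; _⊆_)
open import Data.Product using (Σ; ∃; ∃-syntax; _×_; _,_)
open import Data.Sum using (_⊎_)
open import Data.Empty using (⊥)
open import Relation.Nullary using (¬_; Dec)
open import Relation.Binary.PropositionalEquality using (_≡_; _≢_)
open import Function.Definitions using (Injective)

record Graph (n : ℕ) : Set₁ where
  field
    Adj     : Fin n → Fin n → Set
    adj?    : ∀ u v → Dec (Adj u v)
    sym     : ∀ {u v} → Adj u v → Adj v u
    irrefl  : ∀ {u} → ¬ Adj u u
open Graph public

Succ : (k : ℕ) → Fin k → Fin k → Set
Succ k i j = (toℕ j ≡ suc (toℕ i)) ⊎ ((suc (toℕ i) ≡ k) × (toℕ j ≡ 0))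

CycAdj : (k : ℕ) → Fin k → Fin k → Set
CycAdj k i j = Succ k i j ⊎ Succ k j i

record InducedCycle {n : ℕ} (G : Graph n) (k : ℕ) : Set where
  field
    3≤k     : 3 ≤ k
    c       : Fin k → Fin n
    inj     : Injective _≡_ _≡_ c
    adj→cyc : ∀ i j → Adj G (c i) (c j) → CycAdj k i j
    cyc→adj : ∀ i j → CycAdj k i j → Adj G (c i) (c j)

ChordalityAtMost : {n : ℕ} → Graph n → ℕ → Set
ChordalityAtMost G m = ∀ k → InducedCycle G k → k ≤ m

data PathIn {n : ℕ} (G : Graph n) (W : Subset n) : Fin n → Fin n → Set where
  here : ∀ {u} → u ∈ W → PathIn G W u u
  step : ∀ {u w v} → u ∈ W → Adj G u w → PathIn G W w v → PathIn G W u v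

ConnectedIn : {n : ℕ} → Graph n → Subset n → Set
ConnectedIn G W = ∀ u v → u ∈ W → v ∈ W → PathIn G W u v

NonEmpty : {n : ℕ} → Subset n → Set
NonEmpty W = ∃[ v ] v ∈ W

SetsAdjacent : {n : ℕ} → Graph n → Subset n → Subset n → Set
SetsAdjacent G X Y = ∃[ u ] ∃[ v ] (u ∈ X × v ∈ Y × Adj G u v)

Disjoint : {n : ℕ} → Subset n → Subset n → Set
Disjoint X Y = ∀ v → v ∈ X → v ∈ Y → ⊥

record IsKpStructure {n : ℕ} (G : Graph n) (p : ℕ) (W : Fin p → Subset n) : Set where
  field
    nonempty  : ∀ x → NonEmpty (W x)
    connected : ∀ x → ConnectedIn G (W x)
    disjoint  : ∀ x y → x ≢ y → Disjoint (W x) (W y)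
    adjacent  : ∀ x y → x ≢ y → SetsAdjacent G (W x) (W y)

IsMinimalKpStructure : {n : ℕ} (G : Graph n) (p : ℕ) (W : Fin p → Subset n) → Set
IsMinimalKpStructure G p W =
  IsKpStructure G p W ×
  (¬ (∃[ W' ] (IsKpStructure G p W' × (∀ x → W' x ⊆ W x)
                × (∃[ x ] ∃[ v ] (v ∈ W x × v ∉ W' x)))))

IsClique : {n : ℕ} → Graph n → Subset n → Set
IsClique G X = ∀ u v → u ∈ X → v ∈ X → u ≢ v → Adj G u v

-- Suppose a bag B of a minimal structure contains two non-adjacent vertices. Then G[B] has two
-- non-adjacent non-cut vertices a and b. By minimality, B - a cannot replace B, so some other bag
-- Cᵃ meets B only at a; likewise some bag Cᵇ meets B only at b, and Cᵃ ≠ Cᵇ. An induced a–b path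
-- inside B and an induced b–a path through Cᵇ and Cᵃ have mutually non-adjacent interiors, so
-- together they form an induced cycle. The first path has an inner vertex because a ≁ b, the
-- second has at least two because no vertex of Cᵃ ∪ Cᵇ sees both a and b: the cycle has length
-- at least 5, contradicting chordality at most 4.

module Submission where

open import Defs
open import Data.Nat using (ℕ; suc; _≤_; _<_; z≤n; s≤s)
open import Data.Nat.Properties using (suc-injective; ≤-trans)
open import Data.Nat.Induction using (<-wellFounded)
open import Induction.WellFounded using (Acc; acc)
open import Data.Fin using (Fin; zero; suc; toℕ; _≟_)
open import Data.Fin.Properties using (any?)
open import Data.Fin.Subset using (Subset; _∈_; _∉_; _⊆_; _-_; _─_; _∪_; ⁅_⁆; ∣_∣)
open import Data.Fin.Subset.Properties
  using (_∈?_; x∈⁅x⁆; x∈⁅y⁆⇒x≡y; x∈p∪q⁺; x∈p∪q⁻; p─q⊆p; x∈p∧x≢y⇒x∈p-y; x∈p∧x∉q⇒x∈p─q;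
         p─q─r≡p─q∪r; x∈p⇒∣p-x∣<∣p∣; ⊆-refl)
open import Data.Vec using (_∷_; there; tabulate)
open import Data.Vec.Properties using (lookup∘tabulate; []=⇒lookup; lookup⇒[]=)
open import Data.Unit using (⊤; tt)
open import Data.List using (List; []; _∷_; _++_; _∷ʳ_; length; lookup)
open import Data.List.Relation.Unary.All as All using (All; []; _∷_)
open import Data.List.Relation.Unary.All.Properties using (++⁺; ++⁻ˡ; ++⁻ʳ)
open import Data.List.Properties using (length-++-≤ʳ)
open import Data.List.Membership.Propositional.Properties using (∈-lookup)
open import Data.Product using (∃-syntax; _×_; _,_; proj₁; proj₂)
open import Data.Sum as Sum using (_⊎_; inj₁; inj₂; [_,_]′)
open import Data.Empty using (⊥-elim)
open import Function using (_∘_; _⇔_; mk⇔; Equivalence)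
open import Function.Definitions using (Injective)
open import Relation.Nullary using (¬_; Dec; yes; no; does; contradiction)
open import Relation.Nullary.Decidable using (_×-dec_; _⊎-dec_; ¬?; dec-true)
open import Relation.Unary using (Decidable)
open import Relation.Binary.PropositionalEquality as ≡ using (_≡_; _≢_; refl; trans; subst; cong)

open Equivalence using (to; from)

private
  variable
    m : ℕ
    x y : Fin m
    p q : Subset m

x∉p-x : ∀ (p : Subset m) x → x ∉ p - x
x∉p-x (_ ∷ p) zero    ()
x∉p-x (_ ∷ p) (suc x) (there x∈) = x∉p-x p x x∈

x∈p-y⁻ : x ∈ p - y → x ∈ p × x ≢ y
x∈p-y⁻ {p = p} {y} x∈ = p─q⊆p p ⁅ y ⁆ x∈ , λ { refl → x∉p-x p y x∈ }

∣p─q∪⁅x⁆∣<∣p─q∣ : x ∈ p → x ∉ q → ∣ p ─ (q ∪ ⁅ x ⁆) ∣ < ∣ p ─ q ∣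
∣p─q∪⁅x⁆∣<∣p─q∣ {x = x} {p = p} {q = q} x∈p x∉q =
  subst (λ r → ∣ r ∣ < ∣ p ─ q ∣) (p─q─r≡p─q∪r p q ⁅ x ⁆) (x∈p⇒∣p-x∣<∣p∣ (x∈p∧x∉q⇒x∈p─q x∈p x∉q))

p⊆r∧x∈r⇒p∪⁅x⁆⊆r : ∀ {r} → p ⊆ r → x ∈ r → p ∪ ⁅ x ⁆ ⊆ r
p⊆r∧x∈r⇒p∪⁅x⁆⊆r {p = p} {x} p⊆r x∈r y∈ with x∈p∪q⁻ p ⁅ x ⁆ y∈
... | inj₁ y∈p = p⊆r y∈p
... | inj₂ y∈x = subst (_∈ _) (≡.sym (x∈⁅y⁆⇒x≡y x y∈x)) x∈r

p⊆q∧x∉p⇒p⊆q-x : p ⊆ q → x ∉ p → p ⊆ q - x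
p⊆q∧x∉p⇒p⊆q-x p⊆q x∉p y∈p = x∈p∧x≢y⇒x∈p-y (p⊆q y∈p) λ { refl → x∉p y∈p }

p⊆q∪⁅x⁆⇒p-x⊆q : p ⊆ q ∪ ⁅ x ⁆ → p - x ⊆ q
p⊆q∪⁅x⁆⇒p-x⊆q {q = q} {x} p⊆ y∈ with x∈p-y⁻ y∈
... | y∈p , y≢x with x∈p∪q⁻ q ⁅ x ⁆ (p⊆ y∈p)
...   | inj₁ y∈q = y∈q
...   | inj₂ y∈x = contradiction (x∈⁅y⁆⇒x≡y x y∈x) y≢x

subsetOf : {P : Fin m → Set} → Decidable P → Subset m
subsetOf P? = tabulate (λ x → does (P? x))

module _ {P : Fin m → Set} (P? : Decidable P) where

  ∈-subsetOf⁺ : P x → x ∈ subsetOf P?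
  ∈-subsetOf⁺ {x} px = lookup⇒[]= x _ (trans (lookup∘tabulate _ x) (dec-true (P? x) px))

  ∈-subsetOf⁻ : x ∈ subsetOf P? → P x
  ∈-subsetOf⁻ {x} x∈ with P? x | trans (≡.sym (lookup∘tabulate _ x)) ([]=⇒lookup x∈)
  ... | yes px | _  = px
  ... | no _   | ()

cycAdj-sym : CycAdj m x y → CycAdj m y x
cycAdj-sym = Sum.swap

cycAdj-zero : CycAdj (suc m) zero (suc y) ⇔ (toℕ y ≡ 0 ⊎ suc (toℕ y) ≡ m)
cycAdj-zero = mk⇔ forth back
  where
    forth : CycAdj (suc _) zero (suc _) → _
    forth (inj₁ (inj₁ e))       = inj₁ (suc-injective e)
    forth (inj₂ (inj₂ (e , _))) = inj₂ (suc-injective e)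
    back : _ → CycAdj (suc _) zero (suc _)
    back (inj₁ e) = inj₁ (inj₁ (cong suc e))
    back (inj₂ e) = inj₂ (inj₂ (cong suc e , refl))

cycAdj-suc : CycAdj (suc m) (suc x) (suc y) ⇔ (toℕ y ≡ suc (toℕ x) ⊎ toℕ x ≡ suc (toℕ y))
cycAdj-suc = mk⇔ forth back
  where
    forth : CycAdj (suc _) (suc _) (suc _) → _
    forth (inj₁ (inj₁ e)) = inj₁ (suc-injective e)
    forth (inj₂ (inj₁ e)) = inj₂ (suc-injective e)
    back : _ → CycAdj (suc _) (suc _) (suc _)
    back (inj₁ e) = inj₁ (inj₁ (cong suc e))
    back (inj₂ e) = inj₂ (inj₁ (cong suc e))

¬cycAdj-zero-zero : 2 ≤ m → ¬ CycAdj (suc m) zero zero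
¬cycAdj-zero-zero (s≤s (s≤s _)) (inj₁ (inj₂ (() , _)))
¬cycAdj-zero-zero (s≤s (s≤s _)) (inj₂ (inj₂ (() , _)))

data Last {A : Set} : List A → A → Set where
  last  : ∀ {x} → Last (x ∷ []) x
  later : ∀ {x xs y} → Last xs y → Last (x ∷ xs) y

Last-++⁻ʳ : ∀ {A : Set} (xs : List A) {z zs y} → Last (xs ++ z ∷ zs) y → Last (z ∷ zs) y
Last-++⁻ʳ []           l         = l
Last-++⁻ʳ (x ∷ [])     (later l) = l
Last-++⁻ʳ (x ∷ x′ ∷ xs) (later l) = Last-++⁻ʳ (x′ ∷ xs) l

Last⇒∷ʳ : ∀ {A : Set} {xs : List A} {y} → Last xs y → ∃[ ms ] (xs ≡ ms ∷ʳ y)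
Last⇒∷ʳ last = [] , refl
Last⇒∷ʳ (later {x} l) with Last⇒∷ʳ l
... | ms , refl = x ∷ ms , refl

module _ {n : ℕ} (G : Graph n) where

  infix 4 _~_
  private
    _~_ : Fin n → Fin n → Set
    _~_ = Adj G

    variable
      S T B C : Subset n
      a b r t u v w z : Fin n
      W : Fin m → Subset n
      vs ws : List (Fin n)

  pathIn-source : PathIn G S u v → u ∈ S
  pathIn-source (here u∈)     = u∈
  pathIn-source (step u∈ _ _) = u∈

  pathIn-++ : PathIn G S u w → PathIn G S w v → PathIn G S u v
  pathIn-++ (here _)        q = q
  pathIn-++ (step u∈ u~ p) q = step u∈ u~ (pathIn-++ p q)

  pathIn-reverse : PathIn G S u v → PathIn G S v u
  pathIn-reverse (here u∈)       = here u∈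
  pathIn-reverse (step u∈ u~w p) =
    pathIn-++ (pathIn-reverse p) (step (pathIn-source p) (sym G u~w) (here u∈))

  pathIn-mono : S ⊆ T → PathIn G S u v → PathIn G T u v
  pathIn-mono S⊆T (here u∈)       = here (S⊆T u∈)
  pathIn-mono S⊆T (step u∈ u~w p) = step (S⊆T u∈) u~w (pathIn-mono S⊆T p)

  connectedIn-via : (∀ {x} → x ∈ S → PathIn G S x r) → ConnectedIn G S
  connectedIn-via reach u v u∈ v∈ = pathIn-++ (reach u∈) (pathIn-reverse (reach v∈))

  connectedIn-star : r ∈ S → (∀ {x} → x ∈ S → x ≡ r ⊎ x ~ r) → ConnectedIn G S
  connectedIn-star {r = r} {S} r∈ spoke = connectedIn-via reach
    where
      reach : ∀ {x} → x ∈ S → PathIn G S x r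
      reach x∈ with spoke x∈
      ... | inj₁ refl = here x∈
      ... | inj₂ x~r  = step x∈ x~r (here r∈)

  connectedIn-cong : S ⊆ T → T ⊆ S → ConnectedIn G S → ConnectedIn G T
  connectedIn-cong S⊆T T⊆S conn u v u∈ v∈ = pathIn-mono S⊆T (conn u v (T⊆S u∈) (T⊆S v∈))

  connectedIn-∪⁅⁆ : ConnectedIn G T → t ∈ T → u ~ t → ConnectedIn G (T ∪ ⁅ u ⁆)
  connectedIn-∪⁅⁆ {T} {t} {u} conn t∈ u~t = connectedIn-via reach
    where
      T⊆ : T ⊆ T ∪ ⁅ u ⁆
      T⊆ x∈ = x∈p∪q⁺ (inj₁ x∈)
      reach : ∀ {x} → x ∈ T ∪ ⁅ u ⁆ → PathIn G (T ∪ ⁅ u ⁆) x t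
      reach {x} x∈ with x∈p∪q⁻ T ⁅ u ⁆ x∈
      ... | inj₁ x∈T = pathIn-mono T⊆ (conn x t x∈T t∈)
      ... | inj₂ x∈u with x∈⁅y⁆⇒x≡y u x∈u
      ...   | refl = step x∈ u~t (here (T⊆ t∈))

  IsNonCut : Subset n → Fin n → Set
  IsNonCut S w = ConnectedIn G (S - w)

  edge-leaving : u ∉ T → r ∈ T → PathIn G S u r →
                 ∃[ x ] ∃[ t ] (x ∈ S × x ∉ T × t ∈ T × x ~ t)
  edge-leaving u∉ r∈ (here _) = contradiction r∈ u∉
  edge-leaving {T = T} u∉ r∈ (step {w = w} u∈ u~w p) with w ∈? T
  ... | yes w∈ = _ , w , u∈ , u∉ , w∈ , u~w
  ... | no w∉  = edge-leaving w∉ r∈ p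

  -- Grow T inside S one adjacent vertex at a time; the last vertex added is a non-cut vertex of S.
  nonCut-outside : ConnectedIn G S → T ⊆ S → ConnectedIn G T → r ∈ T →
                   S ⊆ T ⊎ ∃[ w ] (w ∈ S × w ∉ T × IsNonCut S w)
  nonCut-outside {S} {T₀} {r} S-conn = grow T₀ (<-wellFounded _)
    where
      grow : ∀ T → Acc _<_ ∣ S ─ T ∣ → T ⊆ S → ConnectedIn G T → r ∈ T →
             S ⊆ T ⊎ ∃[ w ] (w ∈ S × w ∉ T × IsNonCut S w)
      grow T (acc smaller) T⊆S T-conn r∈T with any? (λ x → x ∈? S ×-dec ¬? (x ∈? T))
      ... | no none = inj₁ S⊆T
        where
          S⊆T : S ⊆ T
          S⊆T {x} x∈S with x ∈? T
          ... | yes x∈T = x∈T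
          ... | no x∉T  = contradiction (x , x∈S , x∉T) none
      ... | yes (u , u∈S , u∉T) with edge-leaving u∉T r∈T (S-conn u r u∈S (T⊆S r∈T))
      ...   | x , t , x∈S , x∉T , t∈T , x~t
            with grow (T ∪ ⁅ x ⁆) (smaller (∣p─q∪⁅x⁆∣<∣p─q∣ x∈S x∉T)) (p⊆r∧x∈r⇒p∪⁅x⁆⊆r T⊆S x∈S)
                      (connectedIn-∪⁅⁆ T-conn t∈T x~t) (x∈p∪q⁺ (inj₁ r∈T))
      ...     | inj₁ S⊆T∪x = inj₂ (x , x∈S , x∉T ,
                  connectedIn-cong (p⊆q∧x∉p⇒p⊆q-x T⊆S x∉T) (p⊆q∪⁅x⁆⇒p-x⊆q S⊆T∪x) T-conn)
      ...     | inj₂ (w , w∈S , w∉T∪x , w-nonCut) =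
                  inj₂ (w , w∈S , w∉T∪x ∘ x∈p∪q⁺ ∘ inj₁ , w-nonCut)

  private
    closedNeighbour? : ∀ S z → Decidable (λ x → x ∈ S × (x ≡ z ⊎ x ~ z))
    closedNeighbour? S z x = x ∈? S ×-dec (x ≟ z ⊎-dec adj? G x z)

  closedNeighbourhood : Subset n → Fin n → Subset n
  closedNeighbourhood S z = subsetOf (closedNeighbour? S z)

  ∈-closedNeighbourhood⁺ : u ∈ S → u ≡ z ⊎ u ~ z → u ∈ closedNeighbourhood S z
  ∈-closedNeighbourhood⁺ {S = S} {z = z} u∈ spoke = ∈-subsetOf⁺ (closedNeighbour? S z) (u∈ , spoke)

  ∈-closedNeighbourhood⁻ : u ∈ closedNeighbourhood S z → u ∈ S × (u ≡ z ⊎ u ~ z)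
  ∈-closedNeighbourhood⁻ {S = S} {z = z} = ∈-subsetOf⁻ (closedNeighbour? S z)

  nonCut-exists : ConnectedIn G S → u ∈ S → v ∈ S → u ≢ v → ∃[ z ] (z ∈ S × IsNonCut S z)
  nonCut-exists {S} {u} {v} S-conn u∈ v∈ u≢v
    with nonCut-outside S-conn ⁅u⁆⊆S (connectedIn-star (x∈⁅x⁆ u) (inj₁ ∘ x∈⁅y⁆⇒x≡y u)) (x∈⁅x⁆ u)
    where
      ⁅u⁆⊆S : ⁅ u ⁆ ⊆ S
      ⁅u⁆⊆S x∈ = subst (_∈ S) (≡.sym (x∈⁅y⁆⇒x≡y u x∈)) u∈
  ... | inj₁ S⊆⁅u⁆              = contradiction (≡.sym (x∈⁅y⁆⇒x≡y u (S⊆⁅u⁆ v∈))) u≢v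
  ... | inj₂ (z , z∈ , _ , z-nc) = z , z∈ , z-nc

  -- Removing a vertex other than the centre of a star leaves a star.
  nonCut-of-universal : z ∈ S → (∀ {x} → x ∈ S → x ≢ z → x ~ z) → u ≢ z → IsNonCut S u
  nonCut-of-universal {z} {S} {u} z∈ universal u≢z =
    connectedIn-star (x∈p∧x≢y⇒x∈p-y z∈ (u≢z ∘ ≡.sym)) spoke
    where
      spoke : ∀ {x} → x ∈ S - u → x ≡ z ⊎ x ~ z
      spoke {x} x∈ with x ≟ z
      ... | yes x≡z = inj₁ x≡z
      ... | no x≢z  = inj₂ (universal (proj₁ (x∈p-y⁻ x∈)) x≢z)

  nonadjacent-nonCut-pair : ConnectedIn G S → u ∈ S → v ∈ S → u ≢ v → ¬ u ~ v →
    ∃[ a ] ∃[ b ] (a ∈ S × b ∈ S × a ≢ b × ¬ a ~ b × IsNonCut S a × IsNonCut S b)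
  nonadjacent-nonCut-pair {S} {u} {v} S-conn u∈ v∈ u≢v u≁v with nonCut-exists S-conn u∈ v∈ u≢v
  ... | z , z∈ , z-nc with any? (λ y → y ∈? S ×-dec ¬? (y ≟ z) ×-dec ¬? (adj? G y z))
  ...   | no none = u , v , u∈ , v∈ , u≢v , u≁v ,
                    nonCut-of-universal z∈ universal u≢z , nonCut-of-universal z∈ universal v≢z
    where
      universal : ∀ {x} → x ∈ S → x ≢ z → x ~ z
      universal {x} x∈ x≢z with adj? G x z
      ... | yes x~z = x~z
      ... | no x≁z  = contradiction (x , x∈ , x≢z , x≁z) none
      u≢z : u ≢ z
      u≢z refl = u≁v (sym G (universal v∈ (u≢v ∘ ≡.sym)))
      v≢z : v ≢ z
      v≢z refl = u≁v (universal u∈ u≢v)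
  ...   | yes (y , y∈ , y≢z , y≁z) with nonCut-outside S-conn N⊆S N-conn z∈N
    where
      N = closedNeighbourhood S z
      N⊆S : N ⊆ S
      N⊆S = proj₁ ∘ ∈-closedNeighbourhood⁻
      z∈N : z ∈ N
      z∈N = ∈-closedNeighbourhood⁺ z∈ (inj₁ refl)
      N-conn : ConnectedIn G N
      N-conn = connectedIn-star z∈N (proj₂ ∘ ∈-closedNeighbourhood⁻)
  ...     | inj₁ S⊆N = ⊥-elim ([ y≢z , y≁z ]′ (proj₂ (∈-closedNeighbourhood⁻ (S⊆N y∈))))
  ...     | inj₂ (w , w∈ , w∉N , w-nc) =
              z , w , z∈ , w∈ , (λ { refl → w∉N (∈-closedNeighbourhood⁺ w∈ (inj₁ refl)) }) ,
              (λ z~w → w∉N (∈-closedNeighbourhood⁺ w∈ (inj₂ (sym G z~w)))) , z-nc , w-nc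

  adjacent? : ∀ S T → Dec (SetsAdjacent G S T)
  adjacent? S T = any? λ u → any? λ v → u ∈? S ×-dec v ∈? T ×-dec adj? G u v

  adjacent-sym : SetsAdjacent G S T → SetsAdjacent G T S
  adjacent-sym (u , v , u∈ , v∈ , u~v) = v , u , v∈ , u∈ , sym G u~v

  adjacent-mono : S ⊆ B → T ⊆ C → SetsAdjacent G S T → SetsAdjacent G B C
  adjacent-mono S⊆B T⊆C (u , v , u∈ , v∈ , u~v) = u , v , S⊆B u∈ , T⊆C v∈ , u~v

  OnlyThrough : Subset n → Fin n → Subset n → Set
  OnlyThrough B a C = ∀ {d c} → d ∈ B → c ∈ C → d ~ c → d ≡ a

  module _ (structure : IsKpStructure G m W) where
    open IsKpStructure structure

    ∉-other-bag : a ∈ W x → y ≢ x → a ∉ W y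
    ∉-other-bag {x = x} {y = y} a∈ y≢x a∈′ = disjoint x y (y≢x ∘ ≡.sym) _ a∈ a∈′

    -- Deleting a from every bag changes only W x, as a lies in no other bag.
    remove-nonCut : a ∈ W x → b ∈ W x → b ≢ a → IsNonCut (W x) a →
                    (∀ y → y ≢ x → SetsAdjacent G (W x - a) (W y)) →
                    IsKpStructure G m (λ y → W y - a)
    remove-nonCut {a} {x} {b} a∈ b∈ b≢a a-nc still-adjacent = record
      { nonempty  = nonempty′
      ; connected = connected′
      ; disjoint  = λ y z y≢z v v∈ v∈′ → disjoint y z y≢z v (shrunk y v∈) (shrunk z v∈′)
      ; adjacent  = adjacent′
      }
      where
        shrunk : ∀ y → W y - a ⊆ W y
        shrunk y = p─q⊆p (W y) ⁅ a ⁆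
        unchanged : ∀ {y} → y ≢ x → W y ⊆ W y - a
        unchanged y≢x = p⊆q∧x∉p⇒p⊆q-x ⊆-refl (∉-other-bag a∈ y≢x)
        nonempty′ : ∀ y → NonEmpty (W y - a)
        nonempty′ y with y ≟ x
        ... | yes refl = b , x∈p∧x≢y⇒x∈p-y b∈ b≢a
        ... | no y≢x with nonempty y
        ...   | v , v∈ = v , unchanged y≢x v∈
        connected′ : ∀ y → ConnectedIn G (W y - a)
        connected′ y with y ≟ x
        ... | yes refl = a-nc
        ... | no y≢x   = connectedIn-cong (unchanged y≢x) (shrunk y) (connected y)
        adjacent′ : ∀ y z → y ≢ z → SetsAdjacent G (W y - a) (W z - a)
        adjacent′ y z y≢z with y ≟ x | z ≟ x
        ... | yes refl | yes refl = contradiction refl y≢z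
        ... | yes refl | no z≢x   = adjacent-mono ⊆-refl (unchanged z≢x) (still-adjacent z z≢x)
        ... | no y≢x   | yes refl =
          adjacent-sym (adjacent-mono ⊆-refl (unchanged y≢x) (still-adjacent y y≢x))
        ... | no y≢x   | no z≢x   = adjacent-mono (unchanged y≢x) (unchanged z≢x) (adjacent y z y≢z)

  private-bag : IsMinimalKpStructure G m W → a ∈ W x → b ∈ W x → b ≢ a → IsNonCut (W x) a →
                ∃[ y ] (y ≢ x × OnlyThrough (W x) a (W y))
  private-bag {W = W} {a} {x} (structure , minimal) a∈ b∈ b≢a a-nc
    with any? (λ y → ¬? (y ≟ x) ×-dec ¬? (adjacent? (W x - a) (W y)))
  ... | yes (y , y≢x , unseen) = y , y≢x , only-through
    where
      only-through : OnlyThrough (W x) a (W y)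
      only-through {d} {c} d∈ c∈ d~c with d ≟ a
      ... | yes d≡a = d≡a
      ... | no d≢a  = contradiction (d , c , x∈p∧x≢y⇒x∈p-y d∈ d≢a , c∈ , d~c) unseen
  ... | no none =
    ⊥-elim (minimal (_ , smaller , (λ y → p─q⊆p (W y) ⁅ a ⁆) , x , a , a∈ , x∉p-x (W x) a))
    where
      still-adjacent : ∀ y → y ≢ x → SetsAdjacent G (W x - a) (W y)
      still-adjacent y y≢x with adjacent? (W x - a) (W y)
      ... | yes seen  = seen
      ... | no unseen = contradiction (y , y≢x , unseen) none
      smaller : IsKpStructure G _ (λ y → W y - a)
      smaller = remove-nonCut structure a∈ b∈ b≢a a-nc still-adjacent

  Apart : Fin n → Fin n → Set
  Apart u v = ¬ u ~ v × u ≢ v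

  apart-sym : Apart u v → Apart v u
  apart-sym (u≁v , u≢v) = u≁v ∘ sym G , u≢v ∘ ≡.sym

  ~⇒≢ : u ~ v → u ≢ v
  ~⇒≢ u~v refl = irrefl G u~v

  -- Attachesˡ u vs (resp. Attachesʳ u vs): u ∷ vs (resp. vs ∷ʳ u) is induced whenever vs is.
  Attachesˡ : Fin n → List (Fin n) → Set
  Attachesˡ u []       = ⊤
  Attachesˡ u (v ∷ vs) = u ~ v × All (Apart u) vs

  Attachesʳ : Fin n → List (Fin n) → Set
  Attachesʳ u []            = ⊤
  Attachesʳ u (v ∷ [])      = u ~ v
  Attachesʳ u (v ∷ v′ ∷ vs) = Apart u v × Attachesʳ u (v′ ∷ vs)

  Induced : List (Fin n) → Set
  Induced []       = ⊤
  Induced (v ∷ vs) = Attachesˡ v vs × Induced vs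

  attachesˡ-lookup : Attachesˡ u vs → ∀ j → (u ~ lookup vs j ⇔ toℕ j ≡ 0) × u ≢ lookup vs j
  attachesˡ-lookup {vs = v ∷ vs} (u~v , _) zero = mk⇔ (λ _ → refl) (λ _ → u~v) , ~⇒≢ u~v
  attachesˡ-lookup {vs = v ∷ vs} (_ , apart) (suc j) with All.lookup apart (∈-lookup j)
  ... | u≁ , u≢ = mk⇔ (⊥-elim ∘ u≁) (λ ()) , u≢

  attachesʳ-lookup : Attachesʳ u vs → ∀ j →
                     (u ~ lookup vs j ⇔ suc (toℕ j) ≡ length vs) × u ≢ lookup vs j
  attachesʳ-lookup {vs = v ∷ []} u~v zero = mk⇔ (λ _ → refl) (λ _ → u~v) , ~⇒≢ u~v
  attachesʳ-lookup {vs = v ∷ v′ ∷ vs} ((u≁v , u≢v) , _) zero = mk⇔ (⊥-elim ∘ u≁v) (λ ()) , u≢v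
  attachesʳ-lookup {vs = v ∷ v′ ∷ vs} (_ , att) (suc j) with attachesʳ-lookup att j
  ... | u~⇔ , u≢ = mk⇔ (cong suc ∘ to u~⇔) (from u~⇔ ∘ suc-injective) , u≢

  induced-lookup-~ : Induced vs → ∀ i j →
                     lookup vs i ~ lookup vs j ⇔ (toℕ j ≡ suc (toℕ i) ⊎ toℕ i ≡ suc (toℕ j))
  induced-lookup-~ {v ∷ vs} _ zero zero = mk⇔ (⊥-elim ∘ irrefl G) [ (λ ()) , (λ ()) ]′
  induced-lookup-~ {v ∷ vs} (att , _) zero (suc j) with attachesˡ-lookup att j
  ... | v~⇔ , _ = mk⇔ (inj₁ ∘ cong suc ∘ to v~⇔) [ from v~⇔ ∘ suc-injective , (λ ()) ]′
  induced-lookup-~ {v ∷ vs} (att , _) (suc i) zero with attachesˡ-lookup att i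
  ... | v~⇔ , _ =
    mk⇔ (inj₂ ∘ cong suc ∘ to v~⇔ ∘ sym G) [ (λ ()) , sym G ∘ from v~⇔ ∘ suc-injective ]′
  induced-lookup-~ {v ∷ vs} (_ , ind) (suc i) (suc j) with induced-lookup-~ ind i j
  ... | ~⇔ =
    mk⇔ (Sum.map (cong suc) (cong suc) ∘ to ~⇔) (from ~⇔ ∘ Sum.map suc-injective suc-injective)

  induced-lookup-injective : Induced vs → Injective _≡_ _≡_ (lookup vs)
  induced-lookup-injective {v ∷ vs} _ {zero} {zero} _ = refl
  induced-lookup-injective {v ∷ vs} (att , _) {zero} {suc j} v≡ =
    contradiction v≡ (proj₂ (attachesˡ-lookup att j))
  induced-lookup-injective {v ∷ vs} (att , _) {suc i} {zero} ≡v =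
    contradiction (≡.sym ≡v) (proj₂ (attachesˡ-lookup att i))
  induced-lookup-injective {v ∷ vs} (_ , ind) {suc i} {suc j} e =
    cong suc (induced-lookup-injective ind e)

  apex-cycle : (∀ j → (u ~ lookup vs j ⇔ (toℕ j ≡ 0 ⊎ suc (toℕ j) ≡ length vs)) × u ≢ lookup vs j) →
               Induced vs → 2 ≤ length vs → InducedCycle G (suc (length vs))
  apex-cycle {u} {vs} apex induced 2≤ = record
    { 3≤k = s≤s 2≤ ; c = c ; inj = inj ; adj→cyc = adj→cyc ; cyc→adj = cyc→adj }
    where
      c : Fin (suc (length vs)) → Fin n
      c = lookup (u ∷ vs)
      adj→cyc : ∀ i j → c i ~ c j → CycAdj _ i j
      adj→cyc zero    zero    u~u = ⊥-elim (irrefl G u~u)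
      adj→cyc zero    (suc j) u~  = from cycAdj-zero (to (proj₁ (apex j)) u~)
      adj→cyc (suc i) zero    ~u  = cycAdj-sym (adj→cyc zero (suc i) (sym G ~u))
      adj→cyc (suc i) (suc j) ~   = from cycAdj-suc (to (induced-lookup-~ induced i j) ~)
      cyc→adj : ∀ i j → CycAdj _ i j → c i ~ c j
      cyc→adj zero    zero    cyc = contradiction cyc (¬cycAdj-zero-zero 2≤)
      cyc→adj zero    (suc j) cyc = from (proj₁ (apex j)) (to cycAdj-zero cyc)
      cyc→adj (suc i) zero    cyc = sym G (cyc→adj zero (suc i) (cycAdj-sym cyc))
      cyc→adj (suc i) (suc j) cyc = from (induced-lookup-~ induced i j) (to cycAdj-suc cyc)
      inj : Injective _≡_ _≡_ c
      inj {zero}  {zero}  _ = refl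
      inj {zero}  {suc j} e = contradiction e (proj₂ (apex j))
      inj {suc i} {zero}  e = contradiction (≡.sym e) (proj₂ (apex i))
      inj {suc i} {suc j} e = cong suc (induced-lookup-injective induced e)

  attachesˡ⇒≢ : Attachesˡ u vs → All (u ≢_) vs
  attachesˡ⇒≢ {vs = []}     _             = []
  attachesˡ⇒≢ {vs = v ∷ vs} (u~v , apart) = ~⇒≢ u~v ∷ All.map proj₂ apart

  attachesˡ-++⁻ˡ : ∀ vs → Attachesˡ u (vs ++ ws) → Attachesˡ u vs
  attachesˡ-++⁻ˡ []       _             = tt
  attachesˡ-++⁻ˡ (v ∷ vs) (u~v , apart) = u~v , ++⁻ˡ vs apart

  attachesʳ-++ : ∀ vs → All (Apart u) vs → Attachesʳ u (w ∷ ws) → Attachesʳ u (vs ++ w ∷ ws)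
  attachesʳ-++ []            _                att = att
  attachesʳ-++ (v ∷ [])      (u#v ∷ _)        att = u#v , att
  attachesʳ-++ (v ∷ v′ ∷ vs) (u#v ∷ u#v′∷vs) att = u#v , attachesʳ-++ (v′ ∷ vs) u#v′∷vs att

  induced-++⁻ˡ : ∀ vs → Induced (vs ++ ws) → Induced vs
  induced-++⁻ˡ []       _           = tt
  induced-++⁻ˡ (v ∷ vs) (att , ind) = attachesˡ-++⁻ˡ vs att , induced-++⁻ˡ vs ind

  induced-++⁻ʳ : ∀ vs → Induced (vs ++ ws) → Induced ws
  induced-++⁻ʳ []       ind       = ind
  induced-++⁻ʳ (v ∷ vs) (_ , ind) = induced-++⁻ʳ vs ind

  induced-∷ʳ⇒≢ : ∀ vs → Induced (vs ∷ʳ u) → All (_≢ u) vs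
  induced-∷ʳ⇒≢ []       _           = []
  induced-∷ʳ⇒≢ (v ∷ vs) (att , ind) = All.head (++⁻ʳ vs (attachesˡ⇒≢ att)) ∷ induced-∷ʳ⇒≢ vs ind

  induced-∷ʳ⇒attachesʳ : ∀ vs → Induced (vs ∷ʳ u) → Attachesʳ u vs
  induced-∷ʳ⇒attachesʳ []            _                 = tt
  induced-∷ʳ⇒attachesʳ (v ∷ [])      ((v~u , _) , _)   = sym G v~u
  induced-∷ʳ⇒attachesʳ (v ∷ v′ ∷ vs) ((_ , apart) , ind) =
    apart-sym (All.head (++⁻ʳ vs apart)) , induced-∷ʳ⇒attachesʳ (v′ ∷ vs) ind

  induced-glue : ∀ vs → Induced (vs ∷ʳ w) → Induced (w ∷ ws) → All (λ v → All (Apart v) ws) vs →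
                 Induced (vs ++ w ∷ ws)
  induced-glue []            _                    ind₂ _              = ind₂
  induced-glue (v ∷ [])      ((v~w , _) , _)      ind₂ (v#ws ∷ _)     = (v~w , v#ws) , ind₂
  induced-glue (v ∷ v′ ∷ vs) ((v~v′ , apart) , ind₁) ind₂ (v#ws ∷ aparts) =
    (v~v′ , ++⁺ (++⁻ˡ vs apart) (All.head (++⁻ʳ vs apart) ∷ v#ws)) ,
    induced-glue (v′ ∷ vs) ind₁ ind₂ aparts

  apex-lookup : u ~ v → Attachesʳ u vs → ∀ j →
    (u ~ lookup (v ∷ vs) j ⇔ (toℕ j ≡ 0 ⊎ suc (toℕ j) ≡ length (v ∷ vs))) × u ≢ lookup (v ∷ vs) j
  apex-lookup u~v _ zero = mk⇔ (λ _ → inj₁ refl) (λ _ → u~v) , ~⇒≢ u~v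
  apex-lookup {vs = vs} u~v att (suc j) with attachesʳ-lookup {vs = vs} att j
  ... | u~⇔ , u≢ = mk⇔ (inj₂ ∘ cong suc ∘ to u~⇔) [ (λ ()) , from u~⇔ ∘ suc-injective ]′ , u≢

  glued-cycle : ∀ {a b y z} ms₁ ms₂ → Induced (a ∷ y ∷ ms₁ ∷ʳ b) → Induced (b ∷ z ∷ ms₂ ∷ʳ a) →
                All (λ v → All (Apart v) (z ∷ ms₂)) (y ∷ ms₁) →
                InducedCycle G (length (a ∷ y ∷ ms₁ ++ b ∷ z ∷ ms₂))
  glued-cycle {a} {b} {y} {z} ms₁ ms₂ ((a~y , a#ms₁b) , ind₁) ind₂ aparts =
    apex-cycle (apex-lookup a~y a-closes)
               (induced-glue (y ∷ ms₁) ind₁ (induced-++⁻ˡ (b ∷ z ∷ ms₂) ind₂) aparts)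
               (s≤s (≤-trans (s≤s z≤n) (length-++-≤ʳ (b ∷ z ∷ ms₂) {ms₁})))
    where
      a-closes : Attachesʳ a (ms₁ ++ b ∷ z ∷ ms₂)
      a-closes = attachesʳ-++ ms₁ (++⁻ˡ ms₁ a#ms₁b) (induced-∷ʳ⇒attachesʳ (b ∷ z ∷ ms₂) ind₂)

  Near : Fin n → Fin n → Set
  Near u v = u ≡ v ⊎ u ~ v

  data LastNear (u : Fin n) (vs : List (Fin n)) : Set where
    split : ∀ pre v ws → vs ≡ pre ++ v ∷ ws → Near u v → All (¬_ ∘ Near u) ws → LastNear u vs

  lastNear? : ∀ u vs → LastNear u vs ⊎ All (¬_ ∘ Near u) vs
  lastNear? u []       = inj₂ []
  lastNear? u (v ∷ vs) with lastNear? u vs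
  ... | inj₁ (split pre w ws eq near far) = inj₁ (split (v ∷ pre) w ws (cong (v ∷_) eq) near far)
  ... | inj₂ far with u ≟ v ⊎-dec adj? G u v
  ...   | yes near = inj₁ (split [] v vs refl near far)
  ...   | no ¬near = inj₂ (¬near ∷ far)

  record InducedPathIn (S : Subset n) (a b : Fin n) : Set where
    constructor inducedPath
    field
      rest    : List (Fin n)
      induced : Induced (a ∷ rest)
      ends    : Last (a ∷ rest) b
      within  : All (_∈ S) (a ∷ rest)

  -- Prepend u, cutting the path back to its last vertex equal or adjacent to u.
  inducedPath-extend : u ∈ S → u ~ w → InducedPathIn S w b → InducedPathIn S u b
  inducedPath-extend {u} {S} {w} u∈ u~w (inducedPath t ind ends within) with lastNear? u (w ∷ t)
  ... | inj₂ (¬near ∷ _) = contradiction (inj₂ u~w) ¬near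
  ... | inj₁ (split pre v vs eq near far) = prepend near
    where
      ind′ : Induced (v ∷ vs)
      ind′ = induced-++⁻ʳ pre (subst Induced eq ind)
      ends′ : Last (v ∷ vs) _
      ends′ = Last-++⁻ʳ pre (subst (λ l → Last l _) eq ends)
      within′ : All (_∈ S) (v ∷ vs)
      within′ = ++⁻ʳ pre (subst (All (_∈ S)) eq within)
      prepend : Near u v → InducedPathIn S u _
      prepend (inj₁ refl) = inducedPath vs ind′ ends′ within′
      prepend (inj₂ u~v)  =
        inducedPath (v ∷ vs) ((u~v , All.map (λ ¬near → ¬near ∘ inj₂ , ¬near ∘ inj₁) far) , ind′)
                    (later ends′) (u∈ ∷ within′)

  shortcut : PathIn G S a b → InducedPathIn S a b
  shortcut (here a∈)       = inducedPath [] (tt , tt) last (a∈ ∷ [])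
  shortcut (step u∈ u~w p) = inducedPath-extend u∈ u~w (shortcut p)

  inducedPath-∷ʳ : a ≢ b → InducedPathIn S a b → ∃[ ms ] (Induced (a ∷ ms ∷ʳ b) × All (_∈ S) ms)
  inducedPath-∷ʳ a≢b (inducedPath _ _ last _) = contradiction refl a≢b
  inducedPath-∷ʳ a≢b (inducedPath _ ind (later ends) (_ ∷ within)) with Last⇒∷ʳ ends
  ... | ms , refl = ms , ind , ++⁻ˡ ms within

  interior-≢ : ∀ ms → Induced (a ∷ ms ∷ʳ b) → All (λ v → a ≢ v × v ≢ b) ms
  interior-≢ ms (att , ind) = All.zip (++⁻ˡ ms (attachesˡ⇒≢ att) , induced-∷ʳ⇒≢ ms ind)

  long-induced-cycle : ∀ {Cᵃ Cᵇ} → a ∈ B → b ∈ B → a ≢ b → ¬ a ~ b →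
    Disjoint B Cᵃ → Disjoint B Cᵇ → OnlyThrough B a Cᵃ → OnlyThrough B b Cᵇ →
    PathIn G B a b → PathIn G (Cᵃ ∪ Cᵇ ∪ ⁅ a ⁆ ∪ ⁅ b ⁆) b a →
    ∃[ k ] (InducedCycle G k × 5 ≤ k)
  long-induced-cycle {a} {B} {b} {Cᵃ} {Cᵇ} a∈ b∈ a≢b a≁b B#Cᵃ B#Cᵇ onlyᵃ onlyᵇ p₁ p₂
    with inducedPath-∷ʳ a≢b (shortcut p₁) | inducedPath-∷ʳ (a≢b ∘ ≡.sym) (shortcut p₂)
  ... | ms₁ , ind₁ , ms₁⊆B | ms₂ , ind₂ , ms₂⊆C = close ms₁ ms₂ ind₁ ind₂ sides₁ sides₂
    where
      Side₁ Side₂ : Fin n → Set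
      Side₁ v = v ∈ B × a ≢ v × v ≢ b
      Side₂ v = v ∈ Cᵃ ⊎ v ∈ Cᵇ

      sides₁ : All Side₁ ms₁
      sides₁ = All.zip (ms₁⊆B , interior-≢ ms₁ ind₁)

      side₂ : ∀ {v} → v ∈ Cᵃ ∪ Cᵇ ∪ ⁅ a ⁆ ∪ ⁅ b ⁆ → b ≢ v × v ≢ a → Side₂ v
      side₂ {v} v∈ (b≢v , v≢a) with x∈p∪q⁻ Cᵃ _ v∈
      ... | inj₁ v∈Cᵃ = inj₁ v∈Cᵃ
      ... | inj₂ v∈′ with x∈p∪q⁻ Cᵇ _ v∈′
      ...   | inj₁ v∈Cᵇ = inj₂ v∈Cᵇ
      ...   | inj₂ v∈″ with x∈p∪q⁻ ⁅ a ⁆ ⁅ b ⁆ v∈″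
      ...     | inj₁ v∈a = contradiction (x∈⁅y⁆⇒x≡y a v∈a) v≢a
      ...     | inj₂ v∈b = contradiction (≡.sym (x∈⁅y⁆⇒x≡y b v∈b)) b≢v

      sides₂ : All Side₂ ms₂
      sides₂ = All.zipWith (λ (v∈ , ≢s) → side₂ v∈ ≢s) (ms₂⊆C , interior-≢ ms₂ ind₂)

      apart : ∀ {v w} → Side₁ v → Side₂ w → Apart v w
      apart (v∈ , a≢v , _) (inj₁ w∈) =
        (λ v~w → a≢v (≡.sym (onlyᵃ v∈ w∈ v~w))) , λ { refl → B#Cᵃ _ v∈ w∈ }
      apart (v∈ , _ , v≢b) (inj₂ w∈) =
        (λ v~w → v≢b (onlyᵇ v∈ w∈ v~w)) , λ { refl → B#Cᵇ _ v∈ w∈ }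

      close : ∀ ms₁ ms₂ → Induced (a ∷ ms₁ ∷ʳ b) → Induced (b ∷ ms₂ ∷ʳ a) →
              All Side₁ ms₁ → All Side₂ ms₂ → ∃[ k ] (InducedCycle G k × 5 ≤ k)
      close [] _ ((a~b , _) , _) _ _ _ = contradiction a~b a≁b
      close _ [] _ ((b~a , _) , _) _ _ = contradiction (sym G b~a) a≁b
      close _ (z ∷ []) _ ((b~z , _) , (z~a , _) , _) _ (inj₁ z∈Cᵃ ∷ []) =
        contradiction (onlyᵃ b∈ z∈Cᵃ b~z) (a≢b ∘ ≡.sym)
      close _ (z ∷ []) _ ((b~z , _) , (z~a , _) , _) _ (inj₂ z∈Cᵇ ∷ []) =
        contradiction (onlyᵇ a∈ z∈Cᵇ (sym G z~a)) a≢b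
      close (y ∷ ms₁) (z ∷ z′ ∷ ms₂) ind₁ ind₂ sides₁ sides₂ =
        _ , glued-cycle ms₁ (z′ ∷ ms₂) ind₁ ind₂ (All.map (λ s → All.map (apart s) sides₂) sides₁) ,
        s≤s (s≤s (≤-trans (s≤s (s≤s (s≤s z≤n))) (length-++-≤ʳ (b ∷ z ∷ z′ ∷ ms₂) {ms₁})))

  private-neighbour : OnlyThrough B a C → SetsAdjacent G B C → ∃[ c ] (c ∈ C × a ~ c)
  private-neighbour only (d , c , d∈ , c∈ , d~c) with only d∈ c∈ d~c
  ... | refl = c , c∈ , d~c

  walk-through-bags : ∀ {Cᵃ Cᵇ cᵃ cᵇ} → ConnectedIn G Cᵃ → ConnectedIn G Cᵇ → SetsAdjacent G Cᵇ Cᵃ →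
                      cᵃ ∈ Cᵃ → a ~ cᵃ → cᵇ ∈ Cᵇ → b ~ cᵇ → PathIn G (Cᵃ ∪ Cᵇ ∪ ⁅ a ⁆ ∪ ⁅ b ⁆) b a
  walk-through-bags {a} {b} {Cᵃ} {Cᵇ} {cᵃ} {cᵇ}
                    Cᵃ-conn Cᵇ-conn (d , e , d∈ , e∈ , d~e) cᵃ∈ a~cᵃ cᵇ∈ b~cᵇ =
    step b∈ b~cᵇ (pathIn-++ (pathIn-mono Cᵇ⊆ (Cᵇ-conn cᵇ d cᵇ∈ d∈))
      (step (Cᵇ⊆ d∈) d~e (pathIn-++ (pathIn-mono Cᵃ⊆ (Cᵃ-conn e cᵃ e∈ cᵃ∈))
        (step (Cᵃ⊆ cᵃ∈) (sym G a~cᵃ) (here a∈)))))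
    where
      Cᵃ⊆ : Cᵃ ⊆ Cᵃ ∪ Cᵇ ∪ ⁅ a ⁆ ∪ ⁅ b ⁆
      Cᵃ⊆ = x∈p∪q⁺ ∘ inj₁
      Cᵇ⊆ : Cᵇ ⊆ Cᵃ ∪ Cᵇ ∪ ⁅ a ⁆ ∪ ⁅ b ⁆
      Cᵇ⊆ = x∈p∪q⁺ ∘ inj₂ ∘ x∈p∪q⁺ ∘ inj₁
      a∈ : a ∈ Cᵃ ∪ Cᵇ ∪ ⁅ a ⁆ ∪ ⁅ b ⁆
      a∈ = x∈p∪q⁺ (inj₂ (x∈p∪q⁺ (inj₂ (x∈p∪q⁺ (inj₁ (x∈⁅x⁆ a))))))
      b∈ : b ∈ Cᵃ ∪ Cᵇ ∪ ⁅ a ⁆ ∪ ⁅ b ⁆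
      b∈ = x∈p∪q⁺ (inj₂ (x∈p∪q⁺ (inj₂ (x∈p∪q⁺ (inj₂ (x∈⁅x⁆ b))))))

  long-cycle-in-bag : IsMinimalKpStructure G m W → u ∈ W x → v ∈ W x → u ≢ v → ¬ u ~ v →
                      ∃[ k ] (InducedCycle G k × 5 ≤ k)
  long-cycle-in-bag {W = W} {x = x} minimal@(structure , _) u∈ v∈ u≢v u≁v
    with nonadjacent-nonCut-pair (IsKpStructure.connected structure x) u∈ v∈ u≢v u≁v
  ... | a , b , a∈ , b∈ , a≢b , a≁b , a-nc , b-nc
    with private-bag minimal a∈ b∈ (a≢b ∘ ≡.sym) a-nc | private-bag minimal b∈ a∈ a≢b b-nc
  ... | yᵃ , yᵃ≢x , onlyᵃ | yᵇ , yᵇ≢x , onlyᵇ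
    with private-neighbour onlyᵃ (IsKpStructure.adjacent structure x yᵃ (yᵃ≢x ∘ ≡.sym))
       | private-neighbour onlyᵇ (IsKpStructure.adjacent structure x yᵇ (yᵇ≢x ∘ ≡.sym))
  ... | cᵃ , cᵃ∈ , a~cᵃ | cᵇ , cᵇ∈ , b~cᵇ =
    long-induced-cycle a∈ b∈ a≢b a≁b (disjoint x yᵃ (yᵃ≢x ∘ ≡.sym)) (disjoint x yᵇ (yᵇ≢x ∘ ≡.sym))
      onlyᵃ onlyᵇ (connected x a b a∈ b∈)
      (walk-through-bags (connected yᵃ) (connected yᵇ) (adjacent yᵇ yᵃ yᵇ≢yᵃ) cᵃ∈ a~cᵃ cᵇ∈ b~cᵇ)
    where
      open IsKpStructure structure
      yᵇ≢yᵃ : yᵇ ≢ yᵃ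
      yᵇ≢yᵃ refl = a≢b (≡.sym (onlyᵃ b∈ cᵇ∈ b~cᵇ))

chordality≤4⇒no-long-cycle : ∀ {n} (G : Graph n) → ChordalityAtMost G 4 →
                              ¬ (∃[ k ] (InducedCycle G k × 5 ≤ k))
chordality≤4⇒no-long-cycle G chordality (k , cycle , 5≤k) with ≤-trans 5≤k (chordality k cycle)
... | s≤s (s≤s (s≤s (s≤s ())))

corollary1 : (n : ℕ) (G : Graph n) → ChordalityAtMost G 4 →
    (p : ℕ) (W : Fin p → Subset n) → IsMinimalKpStructure G p W →
    ∀ x → IsClique G (W x)
corollary1 n G chordality p W minimal x u v u∈ v∈ u≢v with adj? G u v
... | yes u~v = u~v
... | no u≁v  = contradiction (long-cycle-in-bag G {W = W} {x = x} minimal u∈ v∈ u≢v u≁v)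
                              (chordality≤4⇒no-long-cycle G chordality)
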